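{- Let $k\ge2$, $a_1,\dots,a_k\in\mathbb{Z}$ with $a_1>0$, and let $(f_n)_{n\ge0}$ be defined by $f_0=1$, $f_h=0$ for $h<0$, and $f_n=a_1f_{n-1}+\dots+a_kf_{n-k}$ for $n\ge1$. For $2\le i\le k$ let integers $q_i,r_i$ be such that: if $\sum_{l=1}^i a_l\le0$ then $q_i,r_i>0$ and $|\sum_{l=1}^i a_l|=q_ia_1-r_i$; otherwise $q_i=0$ and $r_i=\sum_{l=1}^i a_l$. If $$a_1-(q_2+1)\ge0,\qquad r_i-(q_i(q_2+1)+q_{i+1}+1)\ge0\ \ (2\le i\le k-1),\qquad r_k-(q_k(q_2+1)+q_k+1)\ge0,$$ then $f_n>0$ for all $n\ge0$. -}

module Defs where

open import Data.Nat using (ℕ; zero; suc)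
open import Data.Integer using (ℤ; _+_; _*_; 0ℤ; 1ℤ)
open import Data.List using (List; []; _∷_)

sumFrom1 : (ℕ → ℤ) → ℕ → ℤ
sumFrom1 g zero = 0ℤ
sumFrom1 g (suc i) = sumFrom1 g i + g (suc i)

-- Given a list  f_{n-1} ∷ f_{n-2} ∷ … ∷ f_0 ∷ []  (most recent first),
-- compute Σ_{l=1}^{k} a_l f_{n-l}, where terms with n-l < 0 are 0
-- (i.e. f_h = 0 for h < 0).
step : (k : ℕ) → (a : ℕ → ℤ) → ℕ → List ℤ → ℤ
step zero    a l xs       = 0ℤ
step (suc k) a l []       = 0ℤ
step (suc k) a l (x ∷ xs) = a l * x + step k a (suc l) xs

history : (k : ℕ) → (a : ℕ → ℤ) → ℕ → List ℤ
history k a zero    = 1ℤ ∷ []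
history k a (suc n) = step k a 1 (history k a n) ∷ history k a n

f : (k : ℕ) → (a : ℕ → ℤ) → ℕ → ℤ
f k a n with history k a n
... | []    = 0ℤ
... | x ∷ _ = x

-- Write u_t = f_{n-t} (with f_h = 0 for h < 0) and Δ_t = u_t - u_{t+1}. The
-- quotient-remainder data says S_i = r_i - q_i a_1 for the partial sums
-- S_i = a_1 + … + a_i. By induction on n, besides u ≥ 0, Δ ≥ 0 and u_0 > 0,
-- the slack
--   Δ_t - Σ_{2 ≤ i < k} q_i Δ_{t+i-1} - q_k u_{t+k-1}
-- stays nonnegative: by Abel summation the slack at the new term f_{n+1} is
--   (a_1 - (q_2 + 1)) · (old slack) + Σ_{2 ≤ i < k} ρ_i Δ_{i-1} + ρ_k u_{k-1},
-- where the ρ_i are exactly the quantities assumed nonnegative, and the new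
-- slack in turn bounds f_{n+1} - f_n from below.
module Submission where

open import Defs
open import Data.Nat using (ℕ; zero; suc; z≤n; s≤s) renaming (_≤_ to _≤ℕ_; _+_ to _+ℕ_)
import Data.Nat.Properties as ℕ
open import Data.Integer using (ℤ; _+_; _-_; _*_; -_; _<_; _≤_; 0ℤ; 1ℤ; +_; ∣_∣; +≤+; +<+)
import Data.Integer.Properties as ℤ
open import Data.Integer.Tactic.RingSolver using (solve-∀)
open import Data.List using (List; []; _∷_)
open import Data.Product using (_×_; _,_)
open import Data.Sum using (_⊎_; inj₁; inj₂)
open import Relation.Binary.PropositionalEquality using (_≡_; refl; sym; trans; cong; cong₂; subst)
open Relation.Binary.PropositionalEquality.≡-Reasoning

*-nonneg : ∀ {x y} → 0ℤ ≤ x → 0ℤ ≤ y → 0ℤ ≤ x * y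
*-nonneg {x} {+ n} 0≤x _ = subst (_≤ x * + n) (ℤ.*-zeroˡ (+ n)) (ℤ.*-monoʳ-≤-nonNeg (+ n) 0≤x)

+-nonneg : ∀ {x y} → 0ℤ ≤ x → 0ℤ ≤ y → 0ℤ ≤ x + y
+-nonneg = ℤ.+-mono-≤

sumBelow : ℕ → (ℕ → ℤ) → ℤ
sumBelow zero    g = 0ℤ
sumBelow (suc n) g = sumBelow n g + g n

sumBelow-cong : ∀ n {g h : ℕ → ℤ} → (∀ j → g j ≡ h j) → sumBelow n g ≡ sumBelow n h
sumBelow-cong zero    g≡h = refl
sumBelow-cong (suc n) g≡h = cong₂ _+_ (sumBelow-cong n g≡h) (g≡h n)

sumBelow-zero : ∀ n {g : ℕ → ℤ} → (∀ j → g j ≡ 0ℤ) → sumBelow n g ≡ 0ℤ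
sumBelow-zero zero    g≡0 = refl
sumBelow-zero (suc n) g≡0 = cong₂ _+_ (sumBelow-zero n g≡0) (g≡0 n)

sumBelow-suc-front : ∀ n (g : ℕ → ℤ) → sumBelow (suc n) g ≡ g 0 + sumBelow n (λ j → g (suc j))
sumBelow-suc-front zero    g = ℤ.+-comm 0ℤ (g 0)
sumBelow-suc-front (suc n) g =
  trans (cong (_+ g (suc n)) (sumBelow-suc-front n g)) (ℤ.+-assoc (g 0) _ _)

sumBelow-nonneg : ∀ n {g : ℕ → ℤ} → (∀ j → suc j ≤ℕ n → 0ℤ ≤ g j) → 0ℤ ≤ sumBelow n g
sumBelow-nonneg zero    g≥0 = +≤+ z≤n
sumBelow-nonneg (suc n) g≥0 =
  +-nonneg (sumBelow-nonneg n (λ j j<n → g≥0 j (ℕ.m≤n⇒m≤1+n j<n))) (g≥0 n ℕ.≤-refl)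

_◂_ : ℤ → (ℕ → ℤ) → ℕ → ℤ
(x ◂ u) zero    = x
(x ◂ u) (suc t) = u t

entry : List ℤ → ℕ → ℤ
entry []       = λ _ → 0ℤ
entry (x ∷ xs) = x ◂ entry xs

step≡sumBelow : ∀ (a : ℕ → ℤ) k l xs → step k a l xs ≡ sumBelow k (λ j → a (l +ℕ j) * entry xs j)
step≡sumBelow a zero    l xs       = refl
step≡sumBelow a (suc k) l []       = sym (sumBelow-zero (suc k) (λ j → ℤ.*-zeroʳ (a (l +ℕ j))))
step≡sumBelow a (suc k) l (x ∷ xs) = begin
  a l * x + step k a (suc l) xs
    ≡⟨ cong (λ s → a l * x + s) (step≡sumBelow a k (suc l) xs) ⟩
  a l * x + sumBelow k (λ j → a (suc l +ℕ j) * entry xs j)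
    ≡⟨ cong (λ s → a l * x + s) (sumBelow-cong k (λ j → cong (λ i → a i * entry xs j) (sym (ℕ.+-suc l j)))) ⟩
  a l * x + sumBelow k (λ j → a (l +ℕ suc j) * entry xs j)
    ≡⟨ cong (_+ _) (cong (λ i → a i * x) (sym (ℕ.+-identityʳ l))) ⟩
  a (l +ℕ 0) * x + sumBelow k (λ j → a (l +ℕ suc j) * entry xs j)
    ≡⟨ sym (sumBelow-suc-front k (λ j → a (l +ℕ j) * entry (x ∷ xs) j)) ⟩
  sumBelow (suc k) (λ j → a (l +ℕ j) * entry (x ∷ xs) j) ∎

f≡entry-history : ∀ k a n → f k a n ≡ entry (history k a n) 0
f≡entry-history k a zero    = refl
f≡entry-history k a (suc n) = refl

QuotRem : ℤ → ℤ → ℤ → ℤ → Set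
QuotRem S q r a₁ = (S ≤ 0ℤ × 0ℤ < q × 0ℤ < r × + ∣ S ∣ ≡ q * a₁ - r) ⊎ (0ℤ < S × q ≡ 0ℤ × r ≡ S)

QuotRem⇒≡r-qa₁ : ∀ {S q r a₁} → QuotRem S q r a₁ → S ≡ r - q * a₁
QuotRem⇒≡r-qa₁ {S} {q} {r} {a₁} (inj₁ (S≤0 , _ , _ , ∣S∣≡)) = begin
  S                 ≡⟨ sym (ℤ.neg-involutive S) ⟩
  - (- S)           ≡⟨ cong -_ (trans (sym (ℤ.0≤i⇒+∣i∣≡i (ℤ.neg-mono-≤ S≤0))) (trans (cong +_ (ℤ.∣-i∣≡∣i∣ S)) ∣S∣≡)) ⟩
  - (q * a₁ - r)    ≡⟨ neg-minus q a₁ r ⟩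
  r - q * a₁        ∎
  where
  neg-minus : ∀ q a₁ r → - (q * a₁ - r) ≡ r - q * a₁
  neg-minus = solve-∀
QuotRem⇒≡r-qa₁ {S} {q} {r} {a₁} (inj₂ (_ , q≡0 , r≡S)) = begin
  S           ≡⟨ sym r≡S ⟩
  r           ≡⟨ minus-zero r a₁ ⟩
  r - 0ℤ * a₁ ≡⟨ cong (λ x → r - x * a₁) (sym q≡0) ⟩
  r - q * a₁  ∎
  where
  minus-zero : ∀ r a₁ → r ≡ r - 0ℤ * a₁
  minus-zero = solve-∀

QuotRem⇒0≤q : ∀ {S q r a₁} → QuotRem S q r a₁ → 0ℤ ≤ q
QuotRem⇒0≤q (inj₁ (_ , 0<q , _)) = ℤ.<⇒≤ 0<q
QuotRem⇒0≤q (inj₂ (_ , q≡0 , _)) = ℤ.≤-reflexive (sym q≡0)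

a≡ΔsumFrom1 : ∀ (a : ℕ → ℤ) i → a (suc i) ≡ sumFrom1 a (suc i) - sumFrom1 a i
a≡ΔsumFrom1 a i = difference (sumFrom1 a i) (a (suc i))
  where
  difference : ∀ s x → x ≡ (s + x) - s
  difference = solve-∀

-- The order of the recurrence is k = p + 2.
module Recurrence (a q r : ℕ → ℤ) where

  c : ℤ
  c = q 2 + 1ℤ

  Δ : (ℕ → ℤ) → ℕ → ℤ
  Δ u t = u t - u (suc t)

  slack : ℕ → (ℕ → ℤ) → ℕ → ℤ
  slack p u t = Δ u t - sumBelow p (λ j → q (2 +ℕ j) * Δ u (t +ℕ suc j)) - q (2 +ℕ p) * u (t +ℕ suc p)

  nextTerm : ℕ → (ℕ → ℤ) → ℤ
  nextTerm p u = sumBelow (2 +ℕ p) (λ j → a (suc j) * u j)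

  margin : ℕ → ℤ
  margin j = r (2 +ℕ j) - (q (2 +ℕ j) * c + q (3 +ℕ j) + 1ℤ)

  lastMargin : ℕ → ℤ
  lastMargin p = r (2 +ℕ p) - (q (2 +ℕ p) * c + q (2 +ℕ p) + 1ℤ)

  RemainderForm : ℕ → Set
  RemainderForm i = sumFrom1 a i ≡ r i - q i * a 1

  Δ≡slack+ : ∀ p u t →
    Δ u t ≡ slack p u t + sumBelow p (λ j → q (2 +ℕ j) * Δ u (t +ℕ suc j)) + q (2 +ℕ p) * u (t +ℕ suc p)
  Δ≡slack+ p u t = identity (Δ u t) _ _
    where
    identity : ∀ d s v → d ≡ ((d - s) - v) + s + v
    identity = solve-∀

  slack-nextTerm : ∀ p u → (∀ j → j ≤ℕ p → RemainderForm (2 +ℕ j)) →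
    slack p (nextTerm p u ◂ u) 0
      ≡ (a 1 - c) * slack p u 0 + sumBelow p (λ j → margin j * Δ u (suc j)) + lastMargin p * u (suc p)
  slack-nextTerm zero u remainder = begin
    (0ℤ + a 1 * u 0 + a 2 * u 1) - u 0 - 0ℤ - q 2 * u 0
      ≡⟨ cong (λ x → (0ℤ + a 1 * u 0 + x * u 1) - u 0 - 0ℤ - q 2 * u 0)
              (trans (a≡ΔsumFrom1 a 1) (cong (_- (0ℤ + a 1)) (remainder 0 z≤n))) ⟩
    (0ℤ + a 1 * u 0 + ((r 2 - q 2 * a 1) - (0ℤ + a 1)) * u 1) - u 0 - 0ℤ - q 2 * u 0
      ≡⟨ identity (u 0) (u 1) (a 1) (q 2) (r 2) ⟩
    (a 1 - c) * ((u 0 - u 1) - 0ℤ - q 2 * u 1) + 0ℤ + lastMargin 0 * u 1 ∎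
    where
    identity : ∀ u₀ u₁ a₁ q₂ r₂ →
      (0ℤ + a₁ * u₀ + ((r₂ - q₂ * a₁) - (0ℤ + a₁)) * u₁) - u₀ - 0ℤ - q₂ * u₀
        ≡ (a₁ - (q₂ + 1ℤ)) * ((u₀ - u₁) - 0ℤ - q₂ * u₁) + 0ℤ + (r₂ - (q₂ * (q₂ + 1ℤ) + q₂ + 1ℤ)) * u₁
    identity = solve-∀
  slack-nextTerm (suc p) u remainder = begin
    slack (suc p) (nextTerm (suc p) u ◂ u) 0
      ≡⟨ split-last (nextTerm p u) (sumBelow p (λ j → q (2 +ℕ j) * Δ u j)) (u 0) (u p) (u (1 +ℕ p)) (u (2 +ℕ p))
                    (a (3 +ℕ p)) (q (2 +ℕ p)) (q (3 +ℕ p)) ⟩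
    slack p (nextTerm p u ◂ u) 0 + (a (3 +ℕ p) * u (2 +ℕ p) + (q (2 +ℕ p) - q (3 +ℕ p)) * u (1 +ℕ p))
      ≡⟨ cong₂ _+_ (slack-nextTerm p u (λ j j≤p → remainder j (ℕ.m≤n⇒m≤1+n j≤p)))
                   (cong (λ x → x * u (2 +ℕ p) + (q (2 +ℕ p) - q (3 +ℕ p)) * u (1 +ℕ p)) a₃₊ₚ≡) ⟩
    (a 1 - c) * slack p u 0 + Z + lastMargin p * u (1 +ℕ p)
      + (((r (3 +ℕ p) - q (3 +ℕ p) * a 1) - (r (2 +ℕ p) - q (2 +ℕ p) * a 1)) * u (2 +ℕ p)
         + (q (2 +ℕ p) - q (3 +ℕ p)) * u (1 +ℕ p))
      ≡⟨ identity Z (sumBelow p (λ j → q (2 +ℕ j) * Δ u (suc j))) (u 0) (u 1) (u (1 +ℕ p)) (u (2 +ℕ p))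
                  (a 1) (q 2) (q (2 +ℕ p)) (q (3 +ℕ p)) (r (2 +ℕ p)) (r (3 +ℕ p)) ⟩
    (a 1 - c) * slack (suc p) u 0 + sumBelow (suc p) (λ j → margin j * Δ u (suc j)) + lastMargin (suc p) * u (2 +ℕ p) ∎
    where
    Z : ℤ
    Z = sumBelow p (λ j → margin j * Δ u (suc j))
    a₃₊ₚ≡ : a (3 +ℕ p) ≡ (r (3 +ℕ p) - q (3 +ℕ p) * a 1) - (r (2 +ℕ p) - q (2 +ℕ p) * a 1)
    a₃₊ₚ≡ = trans (a≡ΔsumFrom1 a (2 +ℕ p)) (cong₂ _-_ (remainder (suc p) ℕ.≤-refl) (remainder p (ℕ.n≤1+n p)))
    split-last : ∀ s X u₀ uₚ uₚ₊₁ uₚ₊₂ aₚ₊₃ qₚ₊₂ qₚ₊₃ →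
      (s + aₚ₊₃ * uₚ₊₂) - u₀ - (X + qₚ₊₂ * (uₚ - uₚ₊₁)) - qₚ₊₃ * uₚ₊₁
        ≡ ((s - u₀) - X - qₚ₊₂ * uₚ) + (aₚ₊₃ * uₚ₊₂ + (qₚ₊₂ - qₚ₊₃) * uₚ₊₁)
    split-last = solve-∀
    identity : ∀ Z W u₀ u₁ uₚ₊₁ uₚ₊₂ a₁ q₂ qₚ₊₂ qₚ₊₃ rₚ₊₂ rₚ₊₃ →
      (a₁ - (q₂ + 1ℤ)) * ((u₀ - u₁) - W - qₚ₊₂ * uₚ₊₁) + Z + (rₚ₊₂ - (qₚ₊₂ * (q₂ + 1ℤ) + qₚ₊₂ + 1ℤ)) * uₚ₊₁
        + (((rₚ₊₃ - qₚ₊₃ * a₁) - (rₚ₊₂ - qₚ₊₂ * a₁)) * uₚ₊₂ + (qₚ₊₂ - qₚ₊₃) * uₚ₊₁)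
      ≡ (a₁ - (q₂ + 1ℤ)) * ((u₀ - u₁) - (W + qₚ₊₂ * (uₚ₊₁ - uₚ₊₂)) - qₚ₊₃ * uₚ₊₂)
        + (Z + (rₚ₊₂ - (qₚ₊₂ * (q₂ + 1ℤ) + qₚ₊₃ + 1ℤ)) * (uₚ₊₁ - uₚ₊₂))
        + (rₚ₊₃ - (qₚ₊₃ * (q₂ + 1ℤ) + qₚ₊₃ + 1ℤ)) * uₚ₊₂
    identity = solve-∀

  module Positivity (m : ℕ)
    (remainder : ∀ j → j ≤ℕ m → RemainderForm (2 +ℕ j))
    (q≥0 : ∀ j → j ≤ℕ m → 0ℤ ≤ q (2 +ℕ j))
    (c≤a₁ : 0ℤ ≤ a 1 - c)
    (margin≥0 : ∀ j → suc j ≤ℕ m → 0ℤ ≤ margin j)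
    (lastMargin≥0 : 0ℤ ≤ lastMargin m)
    where

    record Invariant (u : ℕ → ℤ) : Set where
      field
        slack≥0 : ∀ t → 0ℤ ≤ slack m u t
        Δ≥0     : ∀ t → 0ℤ ≤ Δ u t
        u≥0     : ∀ t → 0ℤ ≤ u t
        u₀>0    : 0ℤ < u 0
    open Invariant

    slack-zero-tail : ∀ d → d - sumBelow m (λ j → q (2 +ℕ j) * 0ℤ) - q (2 +ℕ m) * 0ℤ ≡ d - 0ℤ - 0ℤ
    slack-zero-tail d =
      cong₂ (λ x y → d - x - y) (sumBelow-zero m (λ j → ℤ.*-zeroʳ (q (2 +ℕ j)))) (ℤ.*-zeroʳ (q (2 +ℕ m)))

    invariant-initial : Invariant (entry (1ℤ ∷ []))
    slack≥0 invariant-initial zero    = subst (0ℤ ≤_) (sym (slack-zero-tail 1ℤ)) (+≤+ z≤n)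
    slack≥0 invariant-initial (suc t) = subst (0ℤ ≤_) (sym (slack-zero-tail 0ℤ)) (+≤+ z≤n)
    Δ≥0 invariant-initial zero    = +≤+ z≤n
    Δ≥0 invariant-initial (suc t) = +≤+ z≤n
    u≥0 invariant-initial zero    = +≤+ z≤n
    u≥0 invariant-initial (suc t) = +≤+ z≤n
    u₀>0 invariant-initial = +<+ (s≤s z≤n)

    invariant-next : ∀ {u} → Invariant u → Invariant (nextTerm m u ◂ u)
    invariant-next {u} I = record { slack≥0 = slack′≥0 ; Δ≥0 = Δ′≥0 ; u≥0 = u′≥0 ; u₀>0 = u′₀>0 }
      where
      u′ : ℕ → ℤ
      u′ = nextTerm m u ◂ u

      slack′₀≥0 : 0ℤ ≤ slack m u′ 0
      slack′₀≥0 = subst (0ℤ ≤_) (sym (slack-nextTerm m u remainder))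
        (+-nonneg (+-nonneg (*-nonneg c≤a₁ (slack≥0 I 0))
                            (sumBelow-nonneg m (λ j j<m → *-nonneg (margin≥0 j j<m) (Δ≥0 I (suc j)))))
                  (*-nonneg lastMargin≥0 (u≥0 I (suc m))))

      Δ′₀≥0 : 0ℤ ≤ Δ u′ 0
      Δ′₀≥0 = subst (0ℤ ≤_) (sym (Δ≡slack+ m u′ 0))
        (+-nonneg (+-nonneg slack′₀≥0
                            (sumBelow-nonneg m (λ j j<m → *-nonneg (q≥0 j (ℕ.<⇒≤ j<m)) (Δ≥0 I j))))
                  (*-nonneg (q≥0 m ℕ.≤-refl) (u≥0 I m)))

      u′₀>0 : 0ℤ < u′ 0
      u′₀>0 = ℤ.<-≤-trans (u₀>0 I) (ℤ.0≤i-j⇒j≤i Δ′₀≥0)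

      slack′≥0 : ∀ t → 0ℤ ≤ slack m u′ t
      slack′≥0 zero    = slack′₀≥0
      slack′≥0 (suc t) = slack≥0 I t

      Δ′≥0 : ∀ t → 0ℤ ≤ Δ u′ t
      Δ′≥0 zero    = Δ′₀≥0
      Δ′≥0 (suc t) = Δ≥0 I t

      u′≥0 : ∀ t → 0ℤ ≤ u′ t
      u′≥0 zero    = ℤ.<⇒≤ u′₀>0
      u′≥0 (suc t) = u≥0 I t

    invariant-history : ∀ n → Invariant (entry (history (2 +ℕ m) a n))
    invariant-history zero    = invariant-initial
    invariant-history (suc n) =
      subst (λ s → Invariant (s ◂ entry (history (2 +ℕ m) a n)))
            (sym (step≡sumBelow a (2 +ℕ m) 1 (history (2 +ℕ m) a n)))
            (invariant-next (invariant-history n))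

corollary1 : (k : ℕ) → 2 ≤ℕ k → (a q r : ℕ → ℤ) → 0ℤ < a 1
    → (∀ i → 2 ≤ℕ i → i ≤ℕ k →
         (sumFrom1 a i ≤ 0ℤ × 0ℤ < q i × 0ℤ < r i × + ∣ sumFrom1 a i ∣ ≡ q i * a 1 - r i)
         ⊎ (0ℤ < sumFrom1 a i × q i ≡ 0ℤ × r i ≡ sumFrom1 a i))
    → 0ℤ ≤ a 1 - (q 2 + 1ℤ)
    → (∀ i → 2 ≤ℕ i → suc i ≤ℕ k → 0ℤ ≤ r i - (q i * (q 2 + 1ℤ) + q (suc i) + 1ℤ))
    → 0ℤ ≤ r k - (q k * (q 2 + 1ℤ) + q k + 1ℤ)
    → (n : ℕ) → 0ℤ < f k a n
-- The hypothesis 0 < a 1 is implied by 0 ≤ a 1 - (q 2 + 1) and q 2 ≥ 0.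
corollary1 (suc (suc m)) (s≤s (s≤s z≤n)) a q r _ quotRem c≤a₁ margin≥0 lastMargin≥0 n =
  subst (0ℤ <_) (sym (f≡entry-history _ a n)) (Invariant.u₀>0 (invariant-history n))
  where
  quotRem₂₊ⱼ : ∀ j → j ≤ℕ m → QuotRem (sumFrom1 a (2 +ℕ j)) (q (2 +ℕ j)) (r (2 +ℕ j)) (a 1)
  quotRem₂₊ⱼ j j≤m = quotRem (2 +ℕ j) (s≤s (s≤s z≤n)) (s≤s (s≤s j≤m))

  open Recurrence a q r
  open Positivity m (λ j j≤m → QuotRem⇒≡r-qa₁ (quotRem₂₊ⱼ j j≤m)) (λ j j≤m → QuotRem⇒0≤q (quotRem₂₊ⱼ j j≤m))
                    c≤a₁ (λ j j<m → margin≥0 (2 +ℕ j) (s≤s (s≤s z≤n)) (s≤s (s≤s j<m))) lastMargin≥0
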